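{- Let $p$ be a prime, $n\in\mathbb{N}$, $d\in U_1$ and $0\le j\le i\le n$. Then $\phi_d(P(i,j))\equiv0\pmod{p^{i-j}}$. More precisely: (1) if $p>2$, or $d\in U_2$, or $j>0$, then for $0\le j<i$ we have $\phi_d(P(i,j))\equiv p^{i-j}\pmod{p^{i-j+1}}$; (2) if $p=2$, $d=-1$, $j=0$ and $i>0$, then $\phi_d(P(i,0))=0$; (3) if $p=2$, $d\in -U_v\setminus -U_{v+1}$ for some $v\ge2$, $j=0$ and $i>0$, then $\phi_d(P(i,0))\equiv 2^{i+v-1}\pmod{2^{i+v}}$.
   Context: $G$ is a cyclic group of order $p^n$ with generator $\sigma$, and $\mathbb{Z}G$ its integral group ring. For $0\le j\le i\le n$, $P(i,j)=\sum_{k=0}^{p^{i-j}-1}\sigma^{kp^j}\in\mathbb{Z}G$. For $d\in\mathbb{Z}$, $\phi_d:\mathbb{Z}G\to\mathbb{Z}$ is the homomorphism of additive groups determined by $\sigma^t\mapsto d^t$ for $0\le t<p^n$. $U_i=1+p^i\mathbb{Z}$, $-U_v=\{ -u:u\in U_v\}$. -}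

module Defs where

open import Data.Nat as ℕ using (ℕ; zero; suc; NonZero; _%_; _≡ᵇ_)
open import Data.Nat.Properties using (m^n≢0)
open import Data.Nat.Primality using (Prime; prime⇒nonZero)
open import Data.Integer as ℤ using (ℤ; +_; _-_; _*_; _+_; -_)
open import Data.Integer.Divisibility using (_∣_)
open import Data.Bool using (if_then_else_)

Σ< : ℕ → (ℕ → ℤ) → ℤ
Σ< zero    f = + 0
Σ< (suc m) f = Σ< m f + f m

-- Integral group ring ZG of the cyclic group G = ⟨σ⟩ of order N:
-- an element  Σ_{t<N} a_t σ^t  is represented by its coefficient
-- function t ↦ a_t (only the values at t < N matter).
ZG : ℕ → Set
ZG N = ℕ → ℤ

σ^ : (N : ℕ) .{{_ : NonZero N}} → ℕ → ZG N
σ^ N t s = if s ≡ᵇ (t % N) then + 1 else + 0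

ΣZG : ∀ {N} → ℕ → (ℕ → ZG N) → ZG N
ΣZG m x s = Σ< m (λ k → x k s)

ord : (p n : ℕ) → Prime p → ℕ
ord p n _ = p ℕ.^ n

P : (p n : ℕ) (pr : Prime p) (i j : ℕ) → ZG (ord p n pr)
P p n pr i j =
  ΣZG {ord p n pr} (p ℕ.^ (i ℕ.∸ j))
      (λ k → σ^ (p ℕ.^ n) {{m^n≢0 p n {{prime⇒nonZero pr}}}} (k ℕ.* p ℕ.^ j))

φ : (p n : ℕ) (pr : Prime p) (d : ℤ) → ZG (ord p n pr) → ℤ
φ p n pr d x = Σ< (p ℕ.^ n) (λ t → x t * (d ℤ.^ t))

_≡_[mod_] : ℤ → ℤ → ℕ → Set
a ≡ b [mod m ] = (+ m) ∣ (a - b)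

_∈U[_,_] : ℤ → ℕ → ℕ → Set
d ∈U[ p , v ] = d ≡ + 1 [mod p ℕ.^ v ]

_∈-U[_,_] : ℤ → ℕ → ℕ → Set
d ∈-U[ p , v ] = (- d) ∈U[ p , v ]

-- φ_d(P(i,j)) is the geometric sum G(p^(i-j), D) = 1 + D + ⋯ + D^(p^(i-j)-1) with D = d^(p^j), and
-- G(p^(m+1), D) = G(p, D) · G(p^m, D^p). As D ≡ 1 (mod p), every factor G(p, ·) is ≡ p ≡ 0 (mod p), and
-- D^p ≡ 1 (mod p²) because D^p - 1 = (D - 1) · G(p, D). So all factors after the first are ≡ p (mod p²);
-- the first one is too when p is odd (expand (1 + cp)^k to first order in p) or D ≡ 1 (mod p²), which
-- holds when d ∈ U_2 or j > 0. For p = 2 and j = 0 the first factor is 1 + d: it vanishes for d = -1,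
-- and it is 2^v times an odd number when d ∈ -U_v ∖ -U_(v+1).
module Submission where

open import Defs

module _ where
  import Data.Integer.Properties as ℤ
  open import Algebra.Properties.CommutativeSemigroup ℤ.+-commutativeSemigroup using (interchange)
  open import Data.Bool using (true; false; T; if_then_else_)
  open import Data.Empty using (⊥-elim)
  open import Data.Nat.Base as ℕ using (ℕ; zero; suc; NonZero; _≡ᵇ_; _%_; s≤s)
  import Data.Nat.Properties as ℕ
  import Data.Nat.Divisibility as ℕ
  open import Data.Nat.DivMod using (m%n<n; m<n⇒m%n≡m; m≡m%n+[m/n]*n)
  open import Data.Nat.Primality using (Prime; prime⇒irreducible; prime⇒nonZero)
  open import Data.Integer.Base using (ℤ; +_; -_; _+_; _-_; _*_; _^_; 0ℤ; 1ℤ; -1ℤ)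
  open import Data.Integer.Properties
    using (+-identityˡ; +-identityʳ; +-assoc; *-zeroʳ; *-zeroˡ; *-identityˡ; *-distribˡ-+; *-distribʳ-+;
           ^-distribˡ-+-*; ^-*-assoc; pos-*; *-comm; neg-involutive)
  open import Data.Integer.DivMod using (_%ℕ_; _/ℕ_; n%ℕd<d; a≡a%ℕn+[a/ℕn]*n)
  import Data.Integer.Divisibility.Signed as Signed
  open import Data.Integer.Tactic.RingSolver using (solve-∀)
  open import Data.Product using (∃-syntax; _,_)
  open import Data.Sum using (_⊎_; inj₁; inj₂)
  open import Relation.Nullary using (¬_)
  open import Relation.Binary.PropositionalEquality
  open ≡-Reasoning

  Σ<-split : ∀ a b (f : ℕ → ℤ) → Σ< (a ℕ.+ b) f ≡ Σ< a f + Σ< b (λ k → f (a ℕ.+ k))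
  Σ<-split a zero    f rewrite ℕ.+-identityʳ a = sym (+-identityʳ _)
  Σ<-split a (suc b) f rewrite ℕ.+-suc a b | Σ<-split a b f = +-assoc (Σ< a f) _ _

  Σ<-cong : ∀ M {f g : ℕ → ℤ} → (∀ {k} → k ℕ.< M → f k ≡ g k) → Σ< M f ≡ Σ< M g
  Σ<-cong zero    f≡g = refl
  Σ<-cong (suc M) f≡g = cong₂ _+_ (Σ<-cong M (λ k<M → f≡g (ℕ.m<n⇒m<1+n k<M))) (f≡g ℕ.≤-refl)

  Σ<-*ˡ : ∀ c M (f : ℕ → ℤ) → c * Σ< M f ≡ Σ< M (λ k → c * f k)
  Σ<-*ˡ c zero    f = *-zeroʳ c
  Σ<-*ˡ c (suc M) f rewrite sym (Σ<-*ˡ c M f) = *-distribˡ-+ c (Σ< M f) (f M)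

  Σ<-*ʳ : ∀ M (f : ℕ → ℤ) c → Σ< M f * c ≡ Σ< M (λ k → f k * c)
  Σ<-*ʳ zero    f c = *-zeroˡ c
  Σ<-*ʳ (suc M) f c rewrite sym (Σ<-*ʳ M f c) = *-distribʳ-+ c (Σ< M f) (f M)

  Σ<-+ : ∀ M (f g : ℕ → ℤ) → Σ< M (λ k → f k + g k) ≡ Σ< M f + Σ< M g
  Σ<-+ zero    f g = refl
  Σ<-+ (suc M) f g rewrite Σ<-+ M f g = interchange (Σ< M f) (Σ< M g) (f M) (g M)

  Σ<-zero : ∀ M → Σ< M (λ _ → 0ℤ) ≡ 0ℤ
  Σ<-zero zero    = refl
  Σ<-zero (suc M) rewrite Σ<-zero M = refl

  Σ<-comm : ∀ N M (f : ℕ → ℕ → ℤ) → Σ< N (λ t → Σ< M (λ k → f k t)) ≡ Σ< M (λ k → Σ< N (f k))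
  Σ<-comm zero    M f = sym (Σ<-zero M)
  Σ<-comm (suc N) M f rewrite Σ<-comm N M f = sym (Σ<-+ M (λ k → Σ< N (f k)) (λ k → f k N))

  if-≡ᵇ-refl : ∀ c {x y : ℤ} → (if c ≡ᵇ c then x else y) ≡ x
  if-≡ᵇ-refl zero    = refl
  if-≡ᵇ-refl (suc c) = if-≡ᵇ-refl c

  if-≡ᵇ-≢ : ∀ {t c} {x y : ℤ} → t ≢ c → (if t ≡ᵇ c then x else y) ≡ y
  if-≡ᵇ-≢ {t} {c} t≢c with t ≡ᵇ c in eq
  ... | false = refl
  ... | true  = ⊥-elim (t≢c (ℕ.≡ᵇ⇒≡ t c (subst T (sym eq) _)))

  indicator : ℕ → ℕ → ℤ
  indicator c t = if t ≡ᵇ c then + 1 else + 0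

  Σ<-indicator-≥ : ∀ N c (w : ℕ → ℤ) → N ℕ.≤ c → Σ< N (λ t → indicator c t * w t) ≡ 0ℤ
  Σ<-indicator-≥ zero    c w _   = refl
  Σ<-indicator-≥ (suc N) c w 1+N≤c
    rewrite Σ<-indicator-≥ N c w (ℕ.<⇒≤ 1+N≤c) | if-≡ᵇ-≢ {x = + 1} {+ 0} (ℕ.<⇒≢ 1+N≤c) = refl

  Σ<-indicator : ∀ N c (w : ℕ → ℤ) → c ℕ.< N → Σ< N (λ t → indicator c t * w t) ≡ w c
  Σ<-indicator (suc N) c w c<1+N with ℕ.m<1+n⇒m<n∨m≡n c<1+N
  ... | inj₁ c<N rewrite Σ<-indicator N c w c<N | if-≡ᵇ-≢ {x = + 1} {+ 0} (ℕ.>⇒≢ c<N) = +-identityʳ (w c)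
  ... | inj₂ refl rewrite Σ<-indicator-≥ c c w ℕ.≤-refl | if-≡ᵇ-refl c {+ 1} {+ 0} =
    trans (+-identityˡ _) (*-identityˡ (w c))

  geom : ℕ → ℤ → ℤ
  geom M D = Σ< M (D ^_)

  geom-suc : ∀ M D → geom (suc M) D ≡ 1ℤ + D * geom M D
  geom-suc M D = begin
    geom (1 ℕ.+ M) D              ≡⟨ Σ<-split 1 M (D ^_) ⟩
    1ℤ + Σ< M (λ k → D * D ^ k)   ≡⟨ cong (λ g → 1ℤ + g) (sym (Σ<-*ˡ D M (D ^_))) ⟩
    1ℤ + D * geom M D             ∎

  geom-* : ∀ M q D → geom (q ℕ.* M) D ≡ geom M D * geom q (D ^ M)
  geom-* M zero    D = sym (*-zeroʳ (geom M D))
  geom-* M (suc q) D = begin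
    geom (M ℕ.+ q ℕ.* M) D                        ≡⟨ Σ<-split M (q ℕ.* M) (D ^_) ⟩
    geom M D + Σ< (q ℕ.* M) (λ k → D ^ (M ℕ.+ k))
      ≡⟨ cong (λ g → geom M D + g) (Σ<-cong (q ℕ.* M) (λ {k} _ → ^-distribˡ-+-* D M k)) ⟩
    geom M D + Σ< (q ℕ.* M) (λ k → D ^ M * D ^ k)
      ≡⟨ cong (λ g → geom M D + g) (sym (Σ<-*ˡ (D ^ M) (q ℕ.* M) (D ^_))) ⟩
    geom M D + D ^ M * geom (q ℕ.* M) D           ≡⟨ cong (λ g → geom M D + D ^ M * g) (geom-* M q D) ⟩
    geom M D + D ^ M * (geom M D * geom q (D ^ M)) ≡⟨ factor (geom M D) (D ^ M) (geom q (D ^ M)) ⟩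
    geom M D * (1ℤ + D ^ M * geom q (D ^ M))       ≡⟨ cong (geom M D *_) (sym (geom-suc q (D ^ M))) ⟩
    geom M D * geom (suc q) (D ^ M)               ∎
    where
    factor : ∀ a b c → a + b * (a * c) ≡ a * (1ℤ + b * c)
    factor = solve-∀

  geom-^-suc : ∀ p m D → geom (p ℕ.^ suc m) D ≡ geom p D * geom (p ℕ.^ m) (D ^ p)
  geom-^-suc p m D = trans (cong (λ M → geom M D) (ℕ.*-comm p (p ℕ.^ m))) (geom-* p (p ℕ.^ m) D)

  geom-telescope : ∀ D M → D ^ M ≡ 1ℤ + (D - 1ℤ) * geom M D
  geom-telescope D zero    = sym (cong (λ g → 1ℤ + g) (*-zeroʳ (D - 1ℤ)))
  geom-telescope D (suc M) = begin
    D * D ^ M                          ≡⟨ cong (D *_) (geom-telescope D M) ⟩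
    D * (1ℤ + (D - 1ℤ) * geom M D)      ≡⟨ telescope D (geom M D) ⟩
    1ℤ + (D - 1ℤ) * (1ℤ + D * geom M D) ≡⟨ cong (λ g → 1ℤ + (D - 1ℤ) * g) (sym (geom-suc M D)) ⟩
    1ℤ + (D - 1ℤ) * geom (suc M) D      ∎
    where
    telescope : ∀ D g → D * (1ℤ + (D - 1ℤ) * g) ≡ 1ℤ + (D - 1ℤ) * (1ℤ + D * g)
    telescope = solve-∀

  φ-ΣZG : ∀ p n pr d M (x : ℕ → ZG (ord p n pr)) →
          φ p n pr d (ΣZG {ord p n pr} M x) ≡ Σ< M (λ k → φ p n pr d (x k))
  φ-ΣZG p n pr d M x = begin
    Σ< N (λ t → Σ< M (λ k → x k t) * d ^ t)   ≡⟨ Σ<-cong N (λ {t} _ → Σ<-*ʳ M (λ k → x k t) (d ^ t)) ⟩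
    Σ< N (λ t → Σ< M (λ k → x k t * d ^ t))   ≡⟨ Σ<-comm N M (λ k t → x k t * d ^ t) ⟩
    Σ< M (λ k → Σ< N (λ t → x k t * d ^ t))   ∎
    where N = p ℕ.^ n

  Σ<-σ^ : ∀ N .{{_ : NonZero N}} c (w : ℕ → ℤ) → Σ< N (λ t → σ^ N c t * w t) ≡ w (c % N)
  Σ<-σ^ N c w = Σ<-indicator N (c % N) w (m%n<n c N)

  *p^j<p^n : ∀ p .{{_ : NonZero p}} {i j n k} → j ℕ.≤ i → i ℕ.≤ n → k ℕ.< p ℕ.^ (i ℕ.∸ j) →
             k ℕ.* p ℕ.^ j ℕ.< p ℕ.^ n
  *p^j<p^n p {i} {j} j≤i i≤n k<p^[i∸j] = ℕ.<-≤-trans (ℕ.*-monoˡ-< (p ℕ.^ j) {{ℕ.m^n≢0 p j}} k<p^[i∸j])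
    (ℕ.≤-trans (ℕ.≤-reflexive (trans (sym (ℕ.^-distribˡ-+-* p (i ℕ.∸ j) j)) (cong (p ℕ.^_) (ℕ.m∸n+n≡m j≤i))))
               (ℕ.^-monoʳ-≤ p i≤n))

  φ-P : ∀ p n pr d {i j} → j ℕ.≤ i → i ℕ.≤ n →
        φ p n pr d (P p n pr i j) ≡ geom (p ℕ.^ (i ℕ.∸ j)) (d ^ (p ℕ.^ j))
  φ-P p n pr d {i} {j} j≤i i≤n = begin
    φ p n pr d (P p n pr i j)             ≡⟨ φ-ΣZG p n pr d M _ ⟩
    Σ< M (λ k → Σ< N (λ t → σ^ N (k ℕ.* p ℕ.^ j) t * d ^ t))
                                          ≡⟨ Σ<-cong M (λ {k} _ → Σ<-σ^ N (k ℕ.* p ℕ.^ j) (d ^_)) ⟩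
    Σ< M (λ k → d ^ ((k ℕ.* p ℕ.^ j) % N))
                                          ≡⟨ Σ<-cong M (λ k<M → cong (d ^_) (m<n⇒m%n≡m (*p^j<p^n p j≤i i≤n k<M))) ⟩
    Σ< M (λ k → d ^ (k ℕ.* p ℕ.^ j))        ≡⟨ Σ<-cong M (λ {k} _ → trans (cong (d ^_) (ℕ.*-comm k (p ℕ.^ j)))
                                                                           (sym (^-*-assoc d (p ℕ.^ j) k))) ⟩
    geom M (d ^ (p ℕ.^ j))                ∎
    where
    N = p ℕ.^ n
    M = p ℕ.^ (i ℕ.∸ j)
    instance
      p≢0 : NonZero p
      p≢0 = prime⇒nonZero pr
      N≢0 : NonZero N
      N≢0 = ℕ.m^n≢0 p n

  -- Congruence with an explicit quotient, so that the ring solver can do the arithmetic.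
  infix 4 _≡_[modᶻ_]
  record _≡_[modᶻ_] (x a m : ℤ) : Set where
    constructor congruent
    field
      quotient : ℤ
      equation : x ≡ a + quotient * m

  ≡[modᶻ]-respˡ : ∀ {x y a m} → x ≡ y → y ≡ a [modᶻ m ] → x ≡ a [modᶻ m ]
  ≡[modᶻ]-respˡ refl x≡a = x≡a

  ≡[modᶻ]-resp-mod : ∀ {x a m m′} → m ≡ m′ → x ≡ a [modᶻ m ] → x ≡ a [modᶻ m′ ]
  ≡[modᶻ]-resp-mod refl x≡a = x≡a

  ^-≡1 : ∀ {D m} → D ≡ 1ℤ [modᶻ m ] → ∀ k → D ^ k ≡ 1ℤ [modᶻ m ]
  ^-≡1 D≡1       zero    = congruent 0ℤ refl
  ^-≡1 {m = m} (congruent c refl) (suc k) with ^-≡1 (congruent c refl) k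
  ... | congruent e D^k≡ =
    congruent (c + e + c * e * m) (trans (cong (λ y → (1ℤ + c * m) * y) D^k≡) (product c e m))
    where
    product : ∀ c e m → (1ℤ + c * m) * (1ℤ + e * m) ≡ 1ℤ + (c + e + c * e * m) * m
    product = solve-∀

  geom-≡ : ∀ {D m} → D ≡ 1ℤ [modᶻ m ] → ∀ M → geom M D ≡ + M [modᶻ m ]
  geom-≡ D≡1 zero = congruent 0ℤ refl
  geom-≡ {D} {m} D≡1 (suc M) with geom-≡ D≡1 M | ^-≡1 D≡1 M
  ... | congruent a geom≡ | congruent b D^M≡ =
    congruent (a + b) (trans (cong₂ _+_ geom≡ D^M≡) (sum (+ M) a b m))
    where
    sum : ∀ x a b m → (x + a * m) + (1ℤ + b * m) ≡ (1ℤ + x) + (a + b) * m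
    sum = solve-∀

  ≡0-* : ∀ {x y a b} → x ≡ 0ℤ [modᶻ a ] → y ≡ 0ℤ [modᶻ b ] → x * y ≡ 0ℤ [modᶻ a * b ]
  ≡0-* {a = a} {b} (congruent c refl) (congruent e refl) = congruent (c * e) (product c e a b)
    where
    product : ∀ c e a b → (0ℤ + c * a) * (0ℤ + e * b) ≡ 0ℤ + c * e * (a * b)
    product = solve-∀

  ≡-*-scaled : ∀ {x y a b q} → x ≡ a [modᶻ a * q ] → y ≡ b [modᶻ b * q ] → x * y ≡ a * b [modᶻ a * b * q ]
  ≡-*-scaled {a = a} {b} {q} (congruent c refl) (congruent e refl) =
    congruent (c + e + c * e * q) (product c e a b q)
    where
    product : ∀ c e a b q → (a + c * (a * q)) * (b + e * (b * q)) ≡ a * b + (c + e + c * e * q) * (a * b * q)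
    product = solve-∀

  ≡self⇒≡0 : ∀ {x m} → x ≡ m [modᶻ m ] → x ≡ 0ℤ [modᶻ m ]
  ≡self⇒≡0 {m = m} (congruent c refl) = congruent (1ℤ + c) (shift m c)
    where
    shift : ∀ m c → m + c * m ≡ 0ℤ + (1ℤ + c) * m
    shift = solve-∀

  ^-self-≡1 : ∀ {D m} → D ≡ 1ℤ [modᶻ + m ] → D ^ m ≡ 1ℤ [modᶻ + m * + m ]
  ^-self-≡1 {m = m} (congruent c refl) with geom-≡ (congruent c refl) m
  ... | congruent e geom≡ = congruent (c * (1ℤ + e)) (begin
    D ^ m                             ≡⟨ geom-telescope D m ⟩
    1ℤ + (D - 1ℤ) * geom m D           ≡⟨ cong (λ g → 1ℤ + (D - 1ℤ) * g) geom≡ ⟩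
    1ℤ + (D - 1ℤ) * (+ m + e * + m)    ≡⟨ square c e (+ m) ⟩
    1ℤ + c * (1ℤ + e) * (+ m * + m)    ∎)
    where
    D = 1ℤ + c * + m
    square : ∀ c e m → 1ℤ + ((1ℤ + c * m) - 1ℤ) * (m + e * m) ≡ 1ℤ + c * (1ℤ + e) * (m * m)
    square = solve-∀

  geom-p^-≡0 : ∀ {p D} → D ≡ 1ℤ [modᶻ + p ] → ∀ m → geom (p ℕ.^ m) D ≡ 0ℤ [modᶻ + (p ℕ.^ m) ]
  geom-p^-≡0 D≡1 zero = congruent 1ℤ refl
  geom-p^-≡0 {p} {D} D≡1 (suc m) =
    ≡[modᶻ]-respˡ (geom-^-suc p m D) (≡[modᶻ]-resp-mod (sym (pos-* p (p ℕ.^ m)))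
      (≡0-* (≡self⇒≡0 (geom-≡ D≡1 p)) (geom-p^-≡0 (^-≡1 D≡1 p) m)))

  [1+cP]^k≡1+kcP : ∀ c P k → (1ℤ + c * P) ^ k ≡ 1ℤ + + k * c * P [modᶻ P * P ]
  [1+cP]^k≡1+kcP c P zero    = congruent 0ℤ refl
  [1+cP]^k≡1+kcP c P (suc k) with [1+cP]^k≡1+kcP c P k
  ... | congruent e D^k≡ = congruent (e + + k * c * c + c * e * P)
    (trans (cong (λ y → (1ℤ + c * P) * y) D^k≡) (product c P (+ k) e))
    where
    product : ∀ c P K e → (1ℤ + c * P) * (1ℤ + K * c * P + e * (P * P))
                          ≡ 1ℤ + (1ℤ + K) * c * P + (e + K * c * c + c * e * P) * (P * P)
    product = solve-∀

  triangular : ℕ → ℤ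
  triangular M = Σ< M (λ k → + k)

  geom-≡-triangular : ∀ c P M → geom M (1ℤ + c * P) ≡ + M + triangular M * c * P [modᶻ P * P ]
  geom-≡-triangular c P zero    = congruent 0ℤ refl
  geom-≡-triangular c P (suc M) with geom-≡-triangular c P M | [1+cP]^k≡1+kcP c P M
  ... | congruent e geom≡ | congruent f D^M≡ =
    congruent (e + f) (trans (cong₂ _+_ geom≡ D^M≡) (sum c P (+ M) (triangular M) e f))
    where
    sum : ∀ c P X T e f → (X + T * c * P + e * (P * P)) + (1ℤ + X * c * P + f * (P * P))
                          ≡ (1ℤ + X) + (T + X) * c * P + (e + f) * (P * P)
    sum = solve-∀

  triangular-odd : ∀ h → triangular (suc (h ℕ.+ h)) ≡ + h * + suc (h ℕ.+ h)
  triangular-odd zero    = refl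
  triangular-odd (suc h) rewrite ℕ.+-suc h h | triangular-odd h = step (+ h)
    where
    step : ∀ H → H * (1ℤ + (H + H)) + (1ℤ + (H + H)) + (1ℤ + (1ℤ + (H + H)))
                 ≡ (1ℤ + H) * (1ℤ + (1ℤ + (1ℤ + (H + H))))
    step = solve-∀

  Odd : ℕ → Set
  Odd p = ∃[ h ] p ≡ suc (h ℕ.+ h)

  geom-odd-≡p : ∀ {p} → Odd p → ∀ c → geom p (1ℤ + c * + p) ≡ + p [modᶻ + p * + p ]
  geom-odd-≡p (h , refl) c with geom-≡-triangular c (+ suc (h ℕ.+ h)) (suc (h ℕ.+ h))
  ... | congruent e geom≡ rewrite triangular-odd h =
    congruent (+ h * c + e) (trans geom≡ (absorb (+ suc (h ℕ.+ h)) (+ h) c e))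
    where
    absorb : ∀ P h c e → P + h * P * c * P + e * (P * P) ≡ P + (h * c + e) * (P * P)
    absorb = solve-∀

  geom-p-≡p : ∀ {p D} → D ≡ 1ℤ [modᶻ + p ] → Odd p ⊎ D ≡ 1ℤ [modᶻ + p * + p ] →
              geom p D ≡ + p [modᶻ + p * + p ]
  geom-p-≡p (congruent c refl) (inj₁ odd) = geom-odd-≡p odd c
  geom-p-≡p _                  (inj₂ D≡1) = geom-≡ D≡1 _

  geom-p^-≡p^ : ∀ {p D} → D ≡ 1ℤ [modᶻ + p ] → geom p D ≡ + p [modᶻ + p * + p ] →
                ∀ m → geom (p ℕ.^ m) D ≡ + (p ℕ.^ m) [modᶻ + (p ℕ.^ m) * + p ]
  geom-p^-≡p^ _ _ zero = congruent 0ℤ refl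
  geom-p^-≡p^ {p} {D} D≡1 geom≡p (suc m) =
    ≡[modᶻ]-respˡ (geom-^-suc p m D)
      (subst (λ q → geom p D * geom (p ℕ.^ m) (D ^ p) ≡ q [modᶻ q * + p ]) (sym (pos-* p (p ℕ.^ m)))
        (≡-*-scaled geom≡p (geom-p^-≡p^ (^-≡1 D≡1 p) (geom-≡ (^-self-≡1 D≡1) p) m)))

  ≡[m]∧≢[2m]⇒≡+m[2m] : ∀ {x a m} → x ≡ a [modᶻ m ] → ¬ (x ≡ a [modᶻ m * + 2 ]) → x ≡ a + m [modᶻ m * + 2 ]
  ≡[m]∧≢[2m]⇒≡+m[2m] {x} {a} {m} (congruent w x≡) x≢ = split (w %ℕ 2) (n%ℕd<d w 2) (a≡a%ℕn+[a/ℕn]*n w 2)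
    where
    even : ∀ a u m → a + (0ℤ + u * + 2) * m ≡ a + u * (m * + 2)
    even = solve-∀
    odd : ∀ a u m → a + (1ℤ + u * + 2) * m ≡ (a + m) + u * (m * + 2)
    odd = solve-∀
    split : ∀ r → r ℕ.< 2 → w ≡ + r + (w /ℕ 2) * + 2 → x ≡ a + m [modᶻ m * + 2 ]
    split 0 _ w≡ =
      ⊥-elim (x≢ (congruent (w /ℕ 2) (trans x≡ (trans (cong (λ z → a + z * m) w≡) (even a (w /ℕ 2) m)))))
    split 1 _ w≡ = congruent (w /ℕ 2) (trans x≡ (trans (cong (λ z → a + z * m) w≡) (odd a (w /ℕ 2) m)))
    split (suc (suc _)) (s≤s (s≤s ())) _

  geom-2^-≡ : ∀ {d V} → d ≡ 1ℤ [modᶻ + 2 ] → - d ≡ 1ℤ [modᶻ V ] → ¬ (- d ≡ 1ℤ [modᶻ V * + 2 ]) →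
              ∀ m → geom (2 ℕ.^ suc m) d ≡ V * + (2 ℕ.^ m) [modᶻ V * + (2 ℕ.^ m) * + 2 ]
  geom-2^-≡ {d} {V} d≡1 -d≡1 -d≢1 m = ≡[modᶻ]-respˡ (geom-^-suc 2 m d)
    (≡-*-scaled geom-2≡V (geom-p^-≡p^ (^-≡1 d≡1 2) (geom-≡ (^-self-≡1 d≡1) 2) m))
    where
    negate : ∀ V c → 1ℤ + - ((1ℤ + V) + c * (V * + 2)) * 1ℤ ≡ V + - (1ℤ + c) * (V * + 2)
    negate = solve-∀
    geom-2≡V : geom 2 d ≡ V [modᶻ V * + 2 ]
    geom-2≡V with ≡[m]∧≢[2m]⇒≡+m[2m] -d≡1 -d≢1
    ... | congruent c -d≡ = congruent (- (1ℤ + c)) (begin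
      1ℤ + d * 1ℤ
        ≡⟨ cong (λ y → 1ℤ + y * 1ℤ) (trans (sym (neg-involutive d)) (cong -_ -d≡)) ⟩
      1ℤ + - ((1ℤ + V) + c * (V * + 2)) * 1ℤ
        ≡⟨ negate V c ⟩
      V + - (1ℤ + c) * (V * + 2)
        ∎)

  geom-2^-[-1]≡0 : ∀ m → geom (2 ℕ.^ suc m) -1ℤ ≡ 0ℤ
  geom-2^-[-1]≡0 m = geom-^-suc 2 m -1ℤ  -- the factor geom 2 -1ℤ computes to 0ℤ

  pos-^-suc : ∀ p m → + (p ℕ.^ m) * + p ≡ + (p ℕ.^ suc m)
  pos-^-suc p m = trans (*-comm (+ (p ℕ.^ m)) (+ p)) (sym (pos-* p (p ℕ.^ m)))

  pos-^-+1 : ∀ p m → + (p ℕ.^ m) * + p ≡ + (p ℕ.^ (m ℕ.+ 1))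
  pos-^-+1 p m = trans (pos-^-suc p m) (cong (λ k → + (p ℕ.^ k)) (ℕ.+-comm 1 m))

  pos-^-* : ∀ p m k → + (p ℕ.^ m) * + (p ℕ.^ k) ≡ + (p ℕ.^ (m ℕ.+ k))
  pos-^-* p m k = trans (sym (pos-* (p ℕ.^ m) (p ℕ.^ k))) (cong +_ (sym (ℕ.^-distribˡ-+-* p m k)))

  [mod]⇒[modᶻ] : ∀ {x a m} → x ≡ a [mod m ] → x ≡ a [modᶻ + m ]
  [mod]⇒[modᶻ] {x} {a} m∣x-a with Signed.∣ᵤ⇒∣ m∣x-a
  ... | Signed.divides c x-a≡c*m = congruent c (trans (a+[x-a] x a) (cong (λ y → a + y) x-a≡c*m))
    where
    a+[x-a] : ∀ x a → x ≡ a + (x - a)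
    a+[x-a] = solve-∀

  [modᶻ]⇒[mod] : ∀ {x a m} → x ≡ a [modᶻ + m ] → x ≡ a [mod m ]
  [modᶻ]⇒[mod] {a = a} {m} (congruent c refl) = Signed.∣⇒∣ᵤ (Signed.divides c ([a+y]-a a (c * + m)))
    where
    [a+y]-a : ∀ a y → (a + y) - a ≡ y
    [a+y]-a = solve-∀

  ∈U[p,1]⇒≡1 : ∀ {d p} → d ∈U[ p , 1 ] → d ≡ 1ℤ [modᶻ + p ]
  ∈U[p,1]⇒≡1 {p = p} d∈U = ≡[modᶻ]-resp-mod (cong +_ (ℕ.*-identityʳ p)) ([mod]⇒[modᶻ] d∈U)

  ∈U[p,2]⇒≡1 : ∀ {d p} → d ∈U[ p , 2 ] → d ≡ 1ℤ [modᶻ + p * + p ]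
  ∈U[p,2]⇒≡1 {p = p} d∈U =
    ≡[modᶻ]-resp-mod (trans (cong (λ q → + (p ℕ.* q)) (ℕ.*-identityʳ p)) (pos-* p p)) ([mod]⇒[modᶻ] d∈U)

  prime>2⇒odd : ∀ {p} → Prime p → 2 ℕ.< p → Odd p
  prime>2⇒odd {p} pr 2<p with p % 2 | m%n<n p 2 | m≡m%n+[m/n]*n p 2
  ... | 0 | _ | p≡ with prime⇒irreducible pr (ℕ.divides (p ℕ./ 2) p≡)
  ...   | inj₁ ()
  ...   | inj₂ refl = ⊥-elim (ℕ.<-irrefl refl 2<p)
  prime>2⇒odd {p} pr 2<p | 1 | _ | p≡ =
    p ℕ./ 2 , trans p≡ (cong suc (trans (ℕ.*-comm (p ℕ./ 2) 2) (cong (p ℕ./ 2 ℕ.+_) (ℕ.+-identityʳ (p ℕ./ 2)))))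
  prime>2⇒odd {p} pr 2<p | suc (suc _) | s≤s (s≤s ()) | _

  odd⊎^p^j≡1 : ∀ {p d} j → Prime p → d ∈U[ p , 1 ] → (2 ℕ.< p ⊎ d ∈U[ p , 2 ] ⊎ 0 ℕ.< j) →
               Odd p ⊎ d ^ (p ℕ.^ j) ≡ 1ℤ [modᶻ + p * + p ]
  odd⊎^p^j≡1         j       pr _    (inj₁ 2<p)          = inj₁ (prime>2⇒odd pr 2<p)
  odd⊎^p^j≡1 {p}     j       pr _    (inj₂ (inj₁ d∈U₂)) = inj₂ (^-≡1 (∈U[p,2]⇒≡1 {p = p} d∈U₂) (p ℕ.^ j))
  odd⊎^p^j≡1 {p} {d} (suc j) pr d∈U₁ (inj₂ (inj₂ _))    =
    inj₂ (≡[modᶻ]-respˡ d^p^[1+j]≡ (^-self-≡1 {m = p} (^-≡1 (∈U[p,1]⇒≡1 {p = p} d∈U₁) (p ℕ.^ j))))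
    where
    d^p^[1+j]≡ : d ^ (p ℕ.^ suc j) ≡ (d ^ (p ℕ.^ j)) ^ p
    d^p^[1+j]≡ = trans (cong (d ^_) (ℕ.*-comm p (p ℕ.^ j))) (sym (^-*-assoc d (p ℕ.^ j) p))

  geom-2^-≡2^[m+v] : ∀ {d v} → d ∈U[ 2 , 1 ] → d ∈-U[ 2 , v ] → ¬ (d ∈-U[ 2 , v ℕ.+ 1 ]) →
                 ∀ m → geom (2 ℕ.^ suc m) d ≡ + (2 ℕ.^ (m ℕ.+ v)) [modᶻ + (2 ℕ.^ suc (m ℕ.+ v)) ]
  geom-2^-≡2^[m+v] {d} {v} d∈U₁ -d∈U -d∉U m =
    ≡[modᶻ]-resp-mod (pos-^-suc 2 (m ℕ.+ v)) (subst (λ a → geom (2 ℕ.^ suc m) d ≡ a [modᶻ a * + 2 ])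
      (trans (pos-^-* 2 v m) (cong (λ k → + (2 ℕ.^ k)) (ℕ.+-comm v m)))
      (geom-2^-≡ (∈U[p,1]⇒≡1 d∈U₁) ([mod]⇒[modᶻ] -d∈U)
        (λ -d≡1 → -d∉U ([modᶻ]⇒[mod] (≡[modᶻ]-resp-mod (pos-^-+1 2 v) -d≡1))) m))

open import Data.Nat using (ℕ; suc; _≤_; _<_; _+_; _∸_; _^_; s≤s; z≤n)
open import Data.Nat.Primality using (Prime)
open import Data.Integer as ℤ using (ℤ; +_; -_)
import Data.Integer.Properties as ℤ
open import Data.Product using (_×_; _,_)
open import Data.Sum using (_⊎_)
open import Relation.Nullary using (¬_)
open import Relation.Binary.PropositionalEquality using (_≡_; refl; trans; cong)

lemma2p3 : (p n : ℕ) (pr : Prime p) (d : ℤ) (i j : ℕ) →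
    d ∈U[ p , 1 ] → j ≤ i → i ≤ n →
    (φ p n pr d (P p n pr i j) ≡ + 0 [mod p ^ (i ∸ j) ])
    × ((2 < p ⊎ d ∈U[ p , 2 ] ⊎ 0 < j) → j < i →
        φ p n pr d (P p n pr i j) ≡ + (p ^ (i ∸ j)) [mod p ^ (i ∸ j + 1) ])
    × (p ≡ 2 → d ≡ - (+ 1) → j ≡ 0 → 0 < i →
        φ p n pr d (P p n pr i 0) ≡ + 0)
    × ((v : ℕ) → 2 ≤ v → p ≡ 2 → d ∈-U[ p , v ] → ¬ (d ∈-U[ p , v + 1 ]) →
        j ≡ 0 → 0 < i →
        φ p n pr d (P p n pr i 0) ≡ + (2 ^ (i + v ∸ 1)) [mod 2 ^ (i + v) ])
lemma2p3 p n pr d i j d∈U₁ j≤i i≤n =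
    [modᶻ]⇒[mod] (≡[modᶻ]-respˡ φP≡geom (geom-p^-≡0 D≡1 (i ∸ j)))
  , (λ cases _ → [modᶻ]⇒[mod] (≡[modᶻ]-respˡ φP≡geom (≡[modᶻ]-resp-mod (pos-^-+1 p (i ∸ j))
      (geom-p^-≡p^ D≡1 (geom-p-≡p D≡1 (odd⊎^p^j≡1 j pr d∈U₁ cases)) (i ∸ j)))))
  , (λ { refl refl _ (s≤s {n = m} _) → trans (φ-P 2 n pr d z≤n i≤n) (geom-2^-[-1]≡0 m) })
  , λ { v _ refl -d∈U -d∉U _ (s≤s {n = m} _) →
      [modᶻ]⇒[mod] (≡[modᶻ]-respˡ (trans (φ-P 2 n pr d z≤n i≤n) (cong (geom (2 ^ suc m)) (ℤ.^-identityʳ d)))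
                                  (geom-2^-≡2^[m+v] d∈U₁ -d∈U -d∉U m)) }
  where
  D≡1 : d ℤ.^ (p ^ j) ≡ ℤ.1ℤ [modᶻ + p ]
  D≡1 = ^-≡1 (∈U[p,1]⇒≡1 d∈U₁) (p ^ j)
  φP≡geom : φ p n pr d (P p n pr i j) ≡ geom (p ^ (i ∸ j)) (d ℤ.^ (p ^ j))
  φP≡geom = φ-P p n pr d j≤i i≤n
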